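{- Let $(G,\prec)$ be a Nyldon-like set over $A$. (1) If $(u_1,u_2,\dots,u_k)$ is the $G$-factorization of a word $x\in A^+$, then $u_k$ is the longest suffix of $x$ that lies in $G$. (2) If $x\in G$ and $s$ is a proper suffix of $x$ with $s\in G$, then $s\prec x$.
   Context: $A$ is a finite alphabet with at least two letters. For $w\in A^+$, a $G$-factorization of $w$ is a sequence $(w_1,\dots,w_k)$, $k\ge 1$, of words of $G$ with $w=w_1w_2\cdots w_k$ and $w_1\preceq w_2\preceq\cdots\preceq w_k$. A Nyldon-like set is a pair $(G,\prec)$ with $G\subseteq A^+$ and $\prec$ a total order on $G$ such that: every letter of $A$ lies in $G$; a word $w$ of length at least $2$ lies in $G$ if and only if $w$ has no $G$-factorization with $k\ge 2$ factors; and for all $f,g\in G$ with $fg\in G$ we have $f\prec fg$. Every word of $A^+$ has exactly one $G$-factorization. -}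

module Defs where

open import Data.Nat using (ℕ; _≤_)
open import Data.Fin using (Fin)
open import Data.List using (List; []; _∷_; [_]; _++_; concat; length)
open import Data.Product using (Σ; ∃; _×_; _,_)
open import Data.Sum using (_⊎_)
open import Data.Empty using (⊥)
open import Relation.Nullary using (¬_)
open import Relation.Binary.PropositionalEquality using (_≡_; _≢_)
open import Function.Bundles using (_↔_)

record Alphabet : Set₁ where
  field
    Letter : Set
    size   : ℕ
    finite : Letter ↔ Fin size
    twoLetters : 2 ≤ size

module _ {A : Set} where

  _⪯[_]_ : List A → (List A → List A → Set) → List A → Set
  u ⪯[ _≺_ ] v = (u ≺ v) ⊎ (u ≡ v)

  data Nondecreasing (_≺_ : List A → List A → Set) : List (List A) → Set where
    []  : Nondecreasing _≺_ []
    [-] : ∀ {u} → Nondecreasing _≺_ [ u ]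
    _∷_ : ∀ {u v ws} → u ⪯[ _≺_ ] v → Nondecreasing _≺_ (v ∷ ws) →
          Nondecreasing _≺_ (u ∷ v ∷ ws)

  data AllG (G : List A → Set) : List (List A) → Set where
    []  : AllG G []
    _∷_ : ∀ {u ws} → G u → AllG G ws → AllG G (u ∷ ws)

  record IsFactorization (G : List A → Set) (_≺_ : List A → List A → Set)
                         (w : List A) (ws : List (List A)) : Set where
    field
      nonempty : ws ≢ []
      inG      : AllG G ws
      concatEq : concat ws ≡ w
      sorted   : Nondecreasing _≺_ ws

  IsSuffix : List A → List A → Set
  IsSuffix s x = ∃ λ p → p ++ s ≡ x

  IsProperSuffix : List A → List A → Set
  IsProperSuffix s x = ∃ λ p → (p ≢ []) × (p ++ s ≡ x)

  IsLongestGSuffix : (List A → Set) → List A → List A → Set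
  IsLongestGSuffix G s x =
    IsSuffix s x × G s × (∀ t → IsSuffix t x → G t → length t ≤ length s)

  NonEmpty : List A → Set
  NonEmpty w = w ≢ []

record NyldonLike (Σ' : Alphabet) : Set₁ where
  open Alphabet Σ'
  field
    G   : List Letter → Set
    _≺_ : List Letter → List Letter → Set
    G-nonempty : ∀ w → G w → w ≢ []
    ≺-irrefl   : ∀ u → G u → ¬ (u ≺ u)
    ≺-trans    : ∀ u v w → G u → G v → G w → u ≺ v → v ≺ w → u ≺ w
    ≺-total    : ∀ u v → G u → G v → (u ≺ v) ⊎ (u ≡ v) ⊎ (v ≺ u)
    letters    : ∀ a → G [ a ]
    long-char  : ∀ w → 2 ≤ length w →
                 (G w → ¬ (∃ λ ws → IsFactorization G _≺_ w ws × 2 ≤ length ws)) ×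
                 (¬ (∃ λ ws → IsFactorization G _≺_ w ws × 2 ≤ length ws) → G w)
    prefix-less : ∀ f g → G f → G g → G (f ++ g) → f ≺ (f ++ g)

module Submission where

-- Everything is proved simultaneously with the existence of G-factorizations, by strong
-- induction on the length of the word.
--
-- Longest suffix: let w = v·t, where t is the last factor and v has a factorization with
-- last factor u ⪯ t.  A suffix s ∈ G of w longer than t has the form s'·t with s' a nonempty
-- suffix of v.  By induction the last factor z of a factorization of s' is a G-suffix of v,
-- hence z ⪯ u ⪯ t, so s = s'·t has a factorization with at least two factors: s ∉ G.
--
-- Suffixes below: write x = a·w and let t be the last factor of w = y·t.  Either the last
-- factor of the prefix p = a·y is ⪯ t, and then x ∉ G; or it exceeds t, in which case it
-- cannot lie inside y (it would be ⪯ the last factor of y, which is ⪯ t), so it is p itself.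
-- Then every G-suffix s of w satisfies s ⪯ t ≺ p ≺ p·t = x.

open import Defs
open import Data.List using (List; []; _∷_; [_]; _++_; _∷ʳ_; concat; length; initLast; _∷ʳ′_)
open import Data.List.Properties
  using ( ∷-injective; ∷-injectiveʳ; ++-assoc; ++-identityʳ; ++-cancelʳ; ++-conicalˡ; ++-conicalʳ
        ; length-++; concat-++)
open import Data.Nat using (ℕ; suc; _≤_; _<_; s≤s; z≤n)
open import Data.Nat.Properties using (≤-refl; ≤-trans; ≤-<-trans; <⇒≱; m≤m+n; m≤n+m; m<m+n; +-comm)
open import Data.Nat.Induction using (<-wellFounded)
open import Data.Product using (∃; _×_; _,_; proj₁; proj₂)
open import Data.Sum using (_⊎_; inj₁; inj₂)
open import Data.Empty using (⊥; ⊥-elim)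
open import Function using (_∘_)
open import Induction.WellFounded using (Acc; acc)
open import Relation.Nullary using (¬_; contradiction)
open import Relation.Binary.PropositionalEquality
  using (_≡_; _≢_; refl; sym; trans; cong; subst; subst₂)

module _ {A : Set} where

  private
    variable
      a : A
      s t v x : List A

  ++-split : ∀ (p s v t : List A) → p ++ s ≡ v ++ t →
             (∃ λ r → v ≡ p ++ r × s ≡ r ++ t) ⊎ (∃ λ r → p ≡ v ++ r × t ≡ r ++ s)
  ++-split []      s v       t e = inj₁ (v , refl , e)
  ++-split (c ∷ p) s []      t e = inj₂ (c ∷ p , refl , sym e)
  ++-split (c ∷ p) s (_ ∷ v) t e with ∷-injective e
  ... | refl , e′ with ++-split p s v t e′
  ...   | inj₁ (r , v≡pr , s≡rt) = inj₁ (r , cong (c ∷_) v≡pr , s≡rt)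
  ...   | inj₂ (r , p≡vr , t≡rs) = inj₂ (r , cong (c ∷_) p≡vr , t≡rs)

  length-∷ʳ : ∀ (xs : List A) {x} → length (xs ∷ʳ x) ≡ suc (length xs)
  length-∷ʳ xs = trans (length-++ xs) (+-comm (length xs) 1)

  ∷ʳ≢[] : ∀ (xs : List A) {x} → xs ∷ʳ x ≢ []
  ∷ʳ≢[] xs e with ++-conicalʳ xs _ e
  ... | ()

  prefix-length : ∀ v → length v ≤ length (v ++ t)
  prefix-length {t} v = subst (length v ≤_) (sym (length-++ v)) (m≤m+n (length v) (length t))

  prefix-shorter : ∀ v → t ≢ [] → length v < length (v ++ t)
  prefix-shorter {[]}    v t≢[] = contradiction refl t≢[]
  prefix-shorter {_ ∷ _} v _    = subst (length v <_) (sym (length-++ v)) (m<m+n (length v) (s≤s z≤n))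

  two≤length-++ : v ≢ [] → t ≢ [] → 2 ≤ length (v ++ t)
  two≤length-++ {[]}    v≢[] _ = contradiction refl v≢[]
  two≤length-++ {_ ∷ v} _ t≢[] = s≤s (≤-trans (s≤s z≤n) (prefix-shorter v t≢[]))

  suffix-length : IsSuffix s x → length s ≤ length x
  suffix-length {s} (p , refl) = subst (length s ≤_) (sym (length-++ p)) (m≤n+m (length s) (length p))

  suffix-trans : IsSuffix s t → IsSuffix t x → IsSuffix s x
  suffix-trans {s} (p , refl) (q , refl) = q ++ p , ++-assoc q p s

  suffix-∷⁻ : IsSuffix s (a ∷ x) → s ≡ a ∷ x ⊎ IsSuffix s x
  suffix-∷⁻ ([]    , e) = inj₁ e
  suffix-∷⁻ (_ ∷ p , e) = inj₂ (p , ∷-injectiveʳ e)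

  suffix-++⁻ : ∀ v → IsSuffix s (v ++ t) → IsSuffix s t ⊎ ∃ λ r → IsSuffix r v × s ≡ r ++ t
  suffix-++⁻ {s} {t} v (p , e) with ++-split p s v t e
  ... | inj₁ (r , v≡pr , s≡rt) = inj₂ (r , (p , sym v≡pr) , s≡rt)
  ... | inj₂ (r , _ , t≡rs)    = inj₁ (r , sym t≡rs)

  suffix-of-nonempty-prefix : ∀ v → v ≢ [] → v ++ t ≡ a ∷ x → IsSuffix t x
  suffix-of-nonempty-prefix []      v≢[] _ = contradiction refl v≢[]
  suffix-of-nonempty-prefix (_ ∷ v) _    e = v , ∷-injectiveʳ e

  suffix-≢[] : IsSuffix s x → s ≢ [] → x ≢ []
  suffix-≢[] {s} (p , refl) s≢[] = s≢[] ∘ ++-conicalʳ p s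

  suffix-≡ : IsSuffix s x → length x ≤ length s → s ≡ x
  suffix-≡ ([]    , e)    _  = e
  suffix-≡ (_ ∷ p , refl) le = contradiction le (<⇒≱ (s≤s (suffix-length (p , refl))))

  suffix-of-longer : IsSuffix s x → IsSuffix t x → length s ≤ length t → IsSuffix s t
  suffix-of-longer {s} {t = t} (p , e) (q , e') s≤t with ++-split p s q t (trans e (sym e'))
  ... | inj₁ (r , _ , s≡rt) = [] , sym (suffix-≡ (r , sym s≡rt) s≤t)
  ... | inj₂ (r , _ , t≡rs) = r , sym t≡rs

  suffix⇒≡⊎proper : IsSuffix s x → s ≡ x ⊎ IsProperSuffix s x
  suffix⇒≡⊎proper ([]    , e) = inj₁ e
  suffix⇒≡⊎proper (c ∷ p , e) = inj₂ (c ∷ p , (λ ()) , e)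

  concat-∷ʳ : ∀ (xss : List (List A)) xs → concat (xss ∷ʳ xs) ≡ concat xss ++ xs
  concat-∷ʳ xss xs = trans (sym (concat-++ xss [ xs ])) (cong (concat xss ++_) (++-identityʳ xs))

  AllG-∷ʳ : ∀ {P : List A → Set} {xss xs} → AllG P xss → P xs → AllG P (xss ∷ʳ xs)
  AllG-∷ʳ []          pxs = pxs ∷ []
  AllG-∷ʳ (pys ∷ pxss) pxs = pys ∷ AllG-∷ʳ pxss pxs

  AllG-last : ∀ {P : List A → Set} xss {xs} → AllG P (xss ∷ʳ xs) → P xs
  AllG-last []        (pxs ∷ []) = pxs
  AllG-last (_ ∷ xss) (_ ∷ pxss) = AllG-last xss pxss

  Nondecreasing-∷ʳ : ∀ {R : List A → List A → Set} xss {u t} →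
                     Nondecreasing R (xss ∷ʳ u) → u ⪯[ R ] t → Nondecreasing R (xss ∷ʳ u ∷ʳ t)
  Nondecreasing-∷ʳ []           [-]      u⪯t = u⪯t ∷ [-]
  Nondecreasing-∷ʳ (_ ∷ [])     (le ∷ nd) u⪯t = le ∷ Nondecreasing-∷ʳ [] nd u⪯t
  Nondecreasing-∷ʳ (_ ∷ y ∷ xs) (le ∷ nd) u⪯t = le ∷ Nondecreasing-∷ʳ (y ∷ xs) nd u⪯t

module NyldonLikeProperties {Σ' : Alphabet} (N : NyldonLike Σ') where

  open Alphabet Σ' using (Letter)
  open NyldonLike N

  Word : Set
  Word = List Letter

  _⪯_ : Word → Word → Set
  u ⪯ v = u ⪯[ _≺_ ] v

  private
    variable
      a : Letter
      n : ℕ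
      p s t u v w x z : Word

  ⪯-trans : G x → G u → G v → x ⪯ u → u ⪯ v → x ⪯ v
  ⪯-trans gx gu gv (inj₁ x≺u) (inj₁ u≺v) = inj₁ (≺-trans _ _ _ gx gu gv x≺u u≺v)
  ⪯-trans _  _  _  x⪯u        (inj₂ refl) = x⪯u
  ⪯-trans _  _  _  (inj₂ refl) u⪯v        = u⪯v

  ⪯-≺-trans : G x → G u → G v → x ⪯ u → u ≺ v → x ≺ v
  ⪯-≺-trans gx gu gv (inj₁ x≺u) u≺v = ≺-trans _ _ _ gx gu gv x≺u u≺v
  ⪯-≺-trans _  _  _  (inj₂ refl) u≺v = u≺v

  ⪯⇒≯ : G u → G v → u ⪯ v → ¬ (v ≺ u)
  ⪯⇒≯ gu gv u⪯v v≺u = ≺-irrefl _ gu (⪯-≺-trans gu gv gu u⪯v v≺u)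

  ⪯-or-≻ : G u → G v → u ⪯ v ⊎ v ≺ u
  ⪯-or-≻ gu gv with ≺-total _ _ gu gv
  ... | inj₁ u≺v        = inj₁ (inj₁ u≺v)
  ... | inj₂ (inj₁ u≡v) = inj₁ (inj₂ u≡v)
  ... | inj₂ (inj₂ v≺u) = inj₂ v≺u

  data Fac : Word → Word → Set where
    single : G t → Fac t t
    extend : Fac v u → u ⪯ t → G t → Fac (v ++ t) t

  _⊲_ : Word → Word → Set
  v ⊲ t = ∃ λ u → Fac v u × u ⪯ t

  extend⊲ : v ⊲ t → G t → Fac (v ++ t) t
  extend⊲ (_ , f , u⪯t) = extend f u⪯t

  fac-last-G : Fac w t → G t
  fac-last-G (single gt)     = gt
  fac-last-G (extend _ _ gt) = gt

  fac-last-suffix : Fac w t → IsSuffix t w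
  fac-last-suffix (single _)             = [] , refl
  fac-last-suffix (extend {v = v} _ _ _) = v , refl

  fac-nonempty : Fac w t → w ≢ []
  fac-nonempty (single gt)             = G-nonempty _ gt
  fac-nonempty (extend {v = v} f _ _) = fac-nonempty f ∘ ++-conicalˡ v _

  earlier-factors : Fac w t → List Word
  earlier-factors (single _)             = []
  earlier-factors (extend {u = u} f _ _) = earlier-factors f ∷ʳ u

  fac⇒isFactorization : (f : Fac w t) → IsFactorization G _≺_ w (earlier-factors f ∷ʳ t)
  fac⇒isFactorization (single gt) = record
    { nonempty = λ () ; inG = gt ∷ [] ; concatEq = ++-identityʳ _ ; sorted = [-] }
  fac⇒isFactorization (extend {u = u} {t} f u⪯t gt) = record
    { nonempty = ∷ʳ≢[] (earlier-factors f ∷ʳ u)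
    ; inG      = AllG-∷ʳ (inG F) gt
    ; concatEq = trans (concat-∷ʳ (earlier-factors f ∷ʳ u) t) (cong (_++ t) (concatEq F))
    ; sorted   = Nondecreasing-∷ʳ (earlier-factors f) (sorted F) u⪯t
    }
    where
    open IsFactorization
    F : IsFactorization G _≺_ _ (earlier-factors f ∷ʳ u)
    F = fac⇒isFactorization f

  append-factors : ∀ us → Fac v u → AllG G (us ∷ʳ t) → Nondecreasing _≺_ (u ∷ us ∷ʳ t) →
                   ∃ λ y → y ⊲ t × y ++ t ≡ v ++ concat (us ∷ʳ t)
  append-factors {v} {t = t} [] f _ (u⪯t ∷ [-]) = v , (_ , f , u⪯t) , cong (v ++_) (sym (++-identityʳ t))
  append-factors {v} (x ∷ us) f (gx ∷ gs) (u⪯x ∷ nd) with append-factors us (extend f u⪯x gx) gs nd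
  ... | y , y⊲t , eq = y , y⊲t , trans eq (++-assoc v x _)

  isFactorization⇒⊲ : ∀ us → IsFactorization G _≺_ w (u ∷ us ∷ʳ t) → ∃ λ v → v ⊲ t × v ++ t ≡ w
  isFactorization⇒⊲ us record { inG = gu ∷ gs ; concatEq = refl ; sorted = nd } =
    append-factors us (single gu) gs nd

  isFactorization⇒fac : ∀ us → IsFactorization G _≺_ w (us ∷ʳ t) → Fac w t
  isFactorization⇒fac [] record { inG = gt ∷ [] ; concatEq = refl } =
    subst (λ w → Fac w _) (sym (++-identityʳ _)) (single gt)
  isFactorization⇒fac (_ ∷ us) F with isFactorization⇒⊲ us F
  ... | _ , v⊲t , refl = extend⊲ v⊲t (AllG-last (_ ∷ us) (IsFactorization.inG F))

  Irreducible : Word → Set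
  Irreducible w = ∀ {v t} → v ⊲ t → G t → v ++ t ≢ w

  G⇒irreducible : G w → Irreducible w
  G⇒irreducible gw (u , f , u⪯t) gt refl =
    proj₁ (long-char _ (two≤length-++ (fac-nonempty f) (G-nonempty _ gt))) gw
      (_ , fac⇒isFactorization (extend f u⪯t gt) , two-factors)
    where
    two-factors : 2 ≤ length (earlier-factors f ∷ʳ u ∷ʳ _)
    two-factors = subst (2 ≤_)
      (sym (trans (length-∷ʳ (earlier-factors f ∷ʳ u)) (cong suc (length-∷ʳ (earlier-factors f)))))
      (s≤s (s≤s z≤n))

  irreducible⇒G : 2 ≤ length w → Irreducible w → G w
  irreducible⇒G {w} two irr = proj₂ (long-char w two) λ (ws , F , two-ws) → no-proper ws F two-ws
    where
    no-proper : ∀ ws → IsFactorization G _≺_ w ws → 2 ≤ length ws → ⊥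
    no-proper ws F two-ws with initLast ws
    no-proper .[]               F () | []
    no-proper .([] ∷ʳ t)        F (s≤s ()) | [] ∷ʳ′ t
    no-proper .((_ ∷ us) ∷ʳ t) F _ | (_ ∷ us) ∷ʳ′ t with isFactorization⇒⊲ us F
    ... | _ , v⊲t , eq = irr v⊲t (AllG-last (_ ∷ us) (IsFactorization.inG F)) eq

  G-fac-last : G w → Fac w t → t ≡ w
  G-fac-last _  (single _)          = refl
  G-fac-last gw (extend f u⪯t gt) = ⊥-elim (G⇒irreducible gw (_ , f , u⪯t) gt refl)

  Factorizable LastIsLongest SuffixesBelow : Word → Set
  Factorizable w  = w ≢ [] → ∃ (Fac w)
  LastIsLongest w = ∀ {t s} → Fac w t → IsSuffix s w → G s → length s ≤ length t
  SuffixesBelow w = G w → ∀ {s} → IsProperSuffix s w → G s → s ≺ w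

  record Good (w : Word) : Set where
    field
      factorizable   : Factorizable w
      last-longest   : LastIsLongest w
      suffixes-below : SuffixesBelow w
  open Good

  GoodBelow : ℕ → Set
  GoodBelow n = ∀ {v} → length v < n → Good v

  good-suffix : GoodBelow n → length v < n → IsSuffix u v → Good u
  good-suffix H v<n u⊑v = H (≤-<-trans (suffix-length u⊑v) v<n)

  good-tail : GoodBelow (suc (length w)) → Good w
  good-tail H = H ≤-refl

  suffix-⪯-last : LastIsLongest v → SuffixesBelow u → Fac v u → IsSuffix z v → G z → z ⪯ u
  suffix-⪯-last longest below f z⊑v gz
    with suffix⇒≡⊎proper (suffix-of-longer z⊑v (fac-last-suffix f) (longest f z⊑v gz))
  ... | inj₁ z≡u = inj₂ z≡u
  ... | inj₂ z⊏u = inj₁ (below (fac-last-G f) z⊏u gz)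

  suffix-⊲ : (∀ {r} → IsSuffix r v → Good r) → Fac v u → u ⪯ t → G t → IsSuffix x v → x ≢ [] → x ⊲ t
  suffix-⊲ {u = u} good⊑v f u⪯t gt x⊑v x≢[] with factorizable (good⊑v x⊑v) x≢[]
  ... | z , fx = z , fx , ⪯-trans (fac-last-G fx) (fac-last-G f) gt z⪯u u⪯t
    where
    z⪯u : z ⪯ u
    z⪯u = suffix-⪯-last (last-longest (good⊑v ([] , refl))) (suffixes-below (good⊑v (fac-last-suffix f))) f
            (suffix-trans (fac-last-suffix fx) x⊑v) (fac-last-G fx)

  last-longest-step : GoodBelow (length w) → LastIsLongest w
  last-longest-step H (single _) s⊑t _ = suffix-length s⊑t
  last-longest-step H (extend {v} {t = t} f u⪯t gt) s⊑w gs with suffix-++⁻ v s⊑w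
  ... | inj₁ s⊑t                      = suffix-length s⊑t
  ... | inj₂ ([] , _ , refl)          = ≤-refl
  ... | inj₂ (r@(_ ∷ _) , r⊑v , refl) = ⊥-elim (G⇒irreducible gs r⊲t gt refl)
    where
    r⊲t : r ⊲ t
    r⊲t = suffix-⊲ (good-suffix H (prefix-shorter v (G-nonempty _ gt))) f u⪯t gt r⊑v (λ ())

  cons-letter : GoodBelow (length (a ∷ w)) → Fac w t → ∃ λ p → a ∷ w ≡ p ++ t × (p ⊲ t ⊎ G p × t ≺ p)
  cons-letter {a} _ (single gt) with ⪯-or-≻ (letters a) gt
  ... | inj₁ a⪯t = [ a ] , refl , inj₁ (_ , single (letters a) , a⪯t)
  ... | inj₂ t≺a = [ a ] , refl , inj₂ (letters a , t≺a)
  cons-letter {a} H (extend {y} {q} {t} fy q⪯t gt) =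
    a ∷ y , refl , last-of-prefix (factorizable (H (prefix-shorter (a ∷ y) (G-nonempty t gt))) (λ ()))
    where
    y<ayt : length y < length (a ∷ y ++ t)
    y<ayt = s≤s (prefix-length y)
    last-of-prefix : ∃ (Fac (a ∷ y)) → (a ∷ y) ⊲ t ⊎ G (a ∷ y) × t ≺ (a ∷ y)
    last-of-prefix (pm , fp) with ⪯-or-≻ (fac-last-G fp) gt | suffix-∷⁻ (fac-last-suffix fp)
    ... | inj₁ pm⪯t | _         = inj₁ (pm , fp , pm⪯t)
    ... | inj₂ t≺pm | inj₁ refl = inj₂ (fac-last-G fp , t≺pm)
    ... | inj₂ t≺pm | inj₂ pm⊑y = ⊥-elim (⪯⇒≯ gpm gt (⪯-trans gpm (fac-last-G fy) gt pm⪯q q⪯t) t≺pm)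
      where
      gpm : G pm
      gpm = fac-last-G fp
      pm⪯q : pm ⪯ q
      pm⪯q = suffix-⪯-last (last-longest (H y<ayt))
               (suffixes-below (good-suffix H y<ayt (fac-last-suffix fy))) fy pm⊑y gpm

  cons-irreducible : GoodBelow (length (a ∷ w)) → LastIsLongest (a ∷ w) → Fac w t →
                     a ∷ w ≡ p ++ t → G p → t ≺ p → Irreducible (a ∷ w)
  cons-irreducible {a} {w} {t} {p} H longest ft aw≡pt gp t≺p {v} {t′} (u , fv , u⪯t′) gt′ vt′≡aw =
    ⪯⇒≯ gp gt (subst₂ _⪯_ u≡p (sym t≡t′) u⪯t′) t≺p
    where
    gt : G t
    gt = fac-last-G ft
    t≤t′ : length t ≤ length t′
    t≤t′ = longest (subst (λ x → Fac x t′) vt′≡aw (extend fv u⪯t′ gt′)) (p , sym aw≡pt) gt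
    t′≤t : length t′ ≤ length t
    t′≤t = last-longest (good-tail H) ft (suffix-of-nonempty-prefix v (fac-nonempty fv) vt′≡aw) gt′
    t≡t′ : t ≡ t′
    t≡t′ = suffix-≡ (suffix-of-longer (p , sym aw≡pt) (v , vt′≡aw) t≤t′) t′≤t
    v≡p : v ≡ p
    v≡p = ++-cancelʳ t v p (trans (cong (v ++_) t≡t′) (trans vt′≡aw aw≡pt))
    u≡p : u ≡ p
    u≡p = trans (G-fac-last (subst G (sym v≡p) gp) fv) v≡p

  factorizable-step : GoodBelow (length w) → LastIsLongest w → Factorizable w
  factorizable-step {[]}            _ _       w≢[] = contradiction refl w≢[]
  factorizable-step {a ∷ []}        _ _       _    = [ a ] , single (letters a)
  factorizable-step {a ∷ w@(_ ∷ _)} H longest _ with factorizable (good-tail H) (λ ())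
  ... | t , ft with cons-letter H ft
  ... | p , aw≡pt , inj₁ p⊲t = t , subst (λ x → Fac x t) (sym aw≡pt) (extend⊲ p⊲t (fac-last-G ft))
  ... | p , aw≡pt , inj₂ (gp , t≺p) =
    a ∷ w , single (irreducible⇒G (s≤s (s≤s z≤n)) (cons-irreducible H longest ft aw≡pt gp t≺p))

  cons-suffixes-below : GoodBelow (length (a ∷ w)) → G (a ∷ w) → IsSuffix s w → G s → s ≺ (a ∷ w)
  cons-suffixes-below {a} {w} {s} H gaw s⊑w gs
    with factorizable (good-tail H) (suffix-≢[] s⊑w (G-nonempty _ gs))
  ... | t , ft with cons-letter H ft
  ... | _ , aw≡pt , inj₁ p⊲t        = ⊥-elim (G⇒irreducible gaw p⊲t (fac-last-G ft) (sym aw≡pt))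
  ... | p , aw≡pt , inj₂ (gp , t≺p) = ⪯-≺-trans gs gt gaw s⪯t (≺-trans _ _ _ gt gp gaw t≺p p≺aw)
    where
    gt : G t
    gt = fac-last-G ft
    s⪯t : s ⪯ t
    s⪯t = suffix-⪯-last (last-longest (good-tail H))
            (suffixes-below (good-suffix H ≤-refl (fac-last-suffix ft))) ft s⊑w gs
    p≺aw : p ≺ (a ∷ w)
    p≺aw = subst (p ≺_) (sym aw≡pt) (prefix-less p t gp gt (subst G aw≡pt gaw))

  suffixes-below-step : GoodBelow (length w) → SuffixesBelow w
  suffixes-below-step {[]}    _ gw = contradiction refl (G-nonempty [] gw)
  suffixes-below-step {_ ∷ _} H gw (q , q≢[] , qs≡w) gs =
    cons-suffixes-below H gw (suffix-of-nonempty-prefix q q≢[] qs≡w) gs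

  good : ∀ w → Good w
  good w = good-acc w (<-wellFounded (length w))
    where
    good-acc : ∀ w → Acc _<_ (length w) → Good w
    good-acc w (acc below) = record
      { factorizable   = factorizable-step H (last-longest-step H)
      ; last-longest   = last-longest-step H
      ; suffixes-below = suffixes-below-step H
      }
      where
      H : GoodBelow (length w)
      H v<w = good-acc _ (below v<w)


corollary3p11 : (Σ' : Alphabet) → (N : NyldonLike Σ') →
    (∀ (x : List (Alphabet.Letter Σ')) (us : List (List (Alphabet.Letter Σ')))
       (uk : List (Alphabet.Letter Σ')) →
       NonEmpty x →
       IsFactorization (NyldonLike.G N) (NyldonLike._≺_ N) x (us ∷ʳ uk) →
       IsLongestGSuffix (NyldonLike.G N) uk x)
    × (∀ (x s : List (Alphabet.Letter Σ')) →
       NyldonLike.G N x → IsProperSuffix s x → NyldonLike.G N s →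
       NyldonLike._≺_ N s x)
corollary3p11 Σ' N =
    (λ x us uk _ F → let f = isFactorization⇒fac us F in
       fac-last-suffix f , fac-last-G f , λ s s⊑x gs → last-longest (good x) f s⊑x gs)
  , (λ x s gx s⊏x gs → suffixes-below (good x) gx s⊏x gs)
  where
  open NyldonLikeProperties N
  open Good
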